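{- For integers $m\ge 0$ and $k\ge 2$, $\chi_{la}(Sp(2,\,2+2m,\,2+2m+k))=4$.
   Context: All graphs are finite, simple and connected. For a graph $G=(V,E)$ with $q=|E|$ edges, a local antimagic labeling of $G$ is a bijection $f:E\to\{1,\dots,q\}$ such that $f^+(x)\ne f^+(y)$ for every pair of adjacent vertices $x,y$, where $f^+(x)=\sum_{e\ni x} f(e)$. The local antimagic chromatic number $\chi_{la}(G)$ is the minimum, over all local antimagic labelings $f$ of $G$, of the number of distinct values taken by $f^+$. For integers $y_1,y_2,y_3\ge 1$, the spider $Sp(y_1,y_2,y_3)$ is the tree obtained from three paths of lengths (numbers of edges) $y_1,y_2,y_3$ by identifying one end-vertex of each path into a single vertex (the core). -}

module Defs where

open import Data.Nat using (ℕ; zero; suc; _+_; _≤_)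
open import Data.Nat.Properties using (_≟_)
open import Data.Fin using (Fin; toℕ; inject₁) renaming (zero to fzero; suc to fsuc)
import Data.Fin.Properties as FinP
open import Data.Fin.Permutation using (Permutation′; _⟨$⟩ʳ_)
open import Data.Nat.ListAction using (sum)
open import Data.List using (List; map; length; deduplicate; allFin)
open import Data.Product using (_×_; _,_; proj₁; proj₂; ∃)
open import Data.Bool using (Bool; true; false; if_then_else_; _∨_)
open import Relation.Nullary.Decidable using (⌊_⌋)
open import Relation.Binary.PropositionalEquality using (_≡_; _≢_)

record Graph : Set where
  field
    n    : ℕ
    q    : ℕ
    ends : Fin q → Fin n × Fin n
open Graph public

-- An edge labeling is a bijection E → {1,…,q}: edge e gets label 1 + π(e)
-- for a permutation π of Fin q.
Labeling : Graph → Set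
Labeling G = Permutation′ (q G)

label : (G : Graph) → Labeling G → Fin (q G) → ℕ
label G π e = suc (toℕ (π ⟨$⟩ʳ e))

incident : (G : Graph) → Fin (n G) → Fin (q G) → Bool
incident G x e = ⌊ proj₁ (ends G e) FinP.≟ x ⌋ ∨ ⌊ proj₂ (ends G e) FinP.≟ x ⌋

vsum : (G : Graph) → Labeling G → Fin (n G) → ℕ
vsum G π x = sum (map (λ e → if incident G x e then label G π e else 0) (allFin (q G)))

LocalAntimagic : (G : Graph) → Labeling G → Set
LocalAntimagic G π = ∀ e → vsum G π (proj₁ (ends G e)) ≢ vsum G π (proj₂ (ends G e))

colours : (G : Graph) → Labeling G → ℕ
colours G π = length (deduplicate _≟_ (map (vsum G π) (allFin (n G))))

ChiLaIs : Graph → ℕ → Set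
ChiLaIs G k =
  (∃ λ π → LocalAntimagic G π × colours G π ≡ k) ×
  (∀ π → LocalAntimagic G π → k ≤ colours G π)

-- Spider Sp(y1,y2,y3): vertices 0 (core), 1,…,q with q = y1+y2+y3.
-- Edge j (0 ≤ j < q) joins vertex j+1 to vertex j, except that the first
-- edge of each leg (j = 0, j = y1, j = y1+y2) joins vertex j+1 to the core 0.
-- Legs: 0-1-…-y1 ; 0-(y1+1)-…-(y1+y2) ; 0-(y1+y2+1)-…-q.
spiderEnds : (y1 y2 y3 : ℕ) → Fin (y1 + y2 + y3) → Fin (suc (y1 + y2 + y3)) × Fin (suc (y1 + y2 + y3))
spiderEnds y1 y2 y3 e =
  (if ⌊ toℕ e ≟ 0 ⌋ ∨ ⌊ toℕ e ≟ y1 ⌋ ∨ ⌊ toℕ e ≟ y1 + y2 ⌋ then fzero else inject₁ e) , fsuc e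

Spider : ℕ → ℕ → ℕ → Graph
Spider y1 y2 y3 = record { n = suc (y1 + y2 + y3) ; q = y1 + y2 + y3 ; ends = spiderEnds y1 y2 y3 }

-- Write L₂ = 2 + 2m, L₃ = L₂ + k and R = L₂ + L₃, so that the spider has q = R + 2 edges.
--
-- Lower bound: the three leaves receive three distinct labels, all at most q, while the edge
-- labelled q has an end that is not a leaf, whose value therefore exceeds q.
--
-- Upper bound: the first leg is labelled 1, q, and the other legs by zigzag sequences
-- A, B, A − 2, B + 2, … (or A, B, A + 2, B − 2, …) whose consecutive sums alternate between
-- R + 3 and R + 1; when k is odd the third leg is made of two such segments meeting at a vertex
-- of value R + 2. The core gets R + 2 and the leaves R + 1, R + 2 and R, so all vertex values
-- lie in {R, …, R + 3} and adjacent ones differ. The labels on each segment split into two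
-- progressions of step 2, and these progressions fit together into all the odd and all the even
-- numbers up to q; as there are q labels, they form a bijection onto {1, …, q}. Which segment
-- lengths make this fit depends on k mod 4, giving three cases: k even, k ≡ 3 and k ≡ 1 mod 4.

module Submission where

open import Defs
open import Data.Bool using (Bool; true; false; if_then_else_; T; _∨_)
open import Data.Bool.Properties using (if-float; if-cong; if-cong-then; if-cong-else; T-∨; T-≡; ∨-zeroʳ)
open import Data.Empty using (⊥-elim)
open import Data.Fin using (Fin; toℕ; fromℕ; fromℕ<; punchOut) renaming (zero to fzero; suc to fsuc)
import Data.Fin.Properties as FinP
open import Data.Fin.Permutation using (Permutation′; permutation; _⟨$⟩ʳ_; _⟨$⟩ˡ_; inverseˡ; inverseʳ)
open import Data.List using (List; []; _∷_; length; map; tabulate; filter; deduplicate; allFin; applyUpTo)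
open import Data.List.Properties using (filter-notAll; map-tabulate)
open import Data.List.Membership.Propositional using (_∈_; _∉_)
open import Data.List.Membership.Propositional.Properties using (∈-filter⁺; ∈-map⁺; ∈-map⁻; ∈-allFin; ∈-deduplicate⁺; ∈-deduplicate⁻; ∈-applyUpTo⁺)
open import Data.List.Relation.Unary.All using (All; []; _∷_)
import Data.List.Relation.Unary.All as All
open import Data.List.Relation.Unary.Any using (here; there)
import Data.List.Relation.Unary.Any as Any
open import Data.List.Relation.Unary.AllPairs using ([]; _∷_)
open import Data.List.Relation.Unary.Unique.Propositional using (Unique)
open import Data.List.Relation.Unary.Unique.DecPropositional.Properties using (deduplicate-!)
open import Data.Nat
open import Data.Nat.ListAction using (sum)
open import Data.Nat.Properties
open import Algebra.Properties.CommutativeSemigroup +-commutativeSemigroup using (x∙yz≈y∙xz)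
open import Data.Nat.Tactic.RingSolver using (solve-∀)
open import Data.Product using (∃; _×_; _,_; proj₁; proj₂)
open import Data.Sum using (_⊎_; inj₁; inj₂)
import Data.Sum as Sum
open import Data.Unit using (tt)
open import Function using (_∘_; mk⇔; Equivalence)
open import Function.Definitions using (Injective)
open import Relation.Binary.PropositionalEquality
open import Relation.Nullary using (Dec; yes; no; ¬_; ¬?)
open import Relation.Nullary.Decidable using (⌊_⌋; does-⇔; isYes≗does; dec-true; dec-false; toWitness; fromWitness)

injective⇒surjective : ∀ {n} (h : Fin n → Fin n) → Injective _≡_ _≡_ h → ∀ y → ∃ λ x → h x ≡ y
injective⇒surjective {suc n} h h-inj y with FinP.any? (λ x → h x FinP.≟ y)
... | yes hit = hit
... | no miss = ⊥-elim (<-irrefl refl (FinP.injective⇒≤ squeezed-injective))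
  where
  y≢h : ∀ x → y ≢ h x
  y≢h x eq = miss (x , sym eq)
  squeezed-injective : Injective _≡_ _≡_ (λ x → punchOut (y≢h x))
  squeezed-injective eq = h-inj (FinP.punchOut-injective (y≢h _) (y≢h _) eq)

Attains : (ℕ → ℕ) → ℕ → ℕ → Set
Attains f n l = ∃ λ p → p < n × f p ≡ l

Onto : (ℕ → ℕ) → ℕ → Set
Onto f n = ∀ l → 1 ≤ l → l ≤ n → Attains f n l

-- n positions onto n values: the chosen preimages are injective, hence exhaust Fin n.
onto⇒labelling : ∀ {n} (f : ℕ → ℕ) → Onto f n →
                 ∃ λ (π : Permutation′ n) → ∀ e → suc (toℕ (π ⟨$⟩ʳ e)) ≡ f (toℕ e)
onto⇒labelling {n} f onto = permutation h⁻¹ h h⁻¹∘h h∘h⁻¹ , f∘h⁻¹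
  where
  h : Fin n → Fin n
  h y = let p , p<n , _ = onto (suc (toℕ y)) (s≤s z≤n) (FinP.toℕ<n y) in fromℕ< p<n

  f∘h : ∀ y → f (toℕ (h y)) ≡ suc (toℕ y)
  f∘h y = let p , p<n , fp = onto (suc (toℕ y)) (s≤s z≤n) (FinP.toℕ<n y)
          in trans (cong f (FinP.toℕ-fromℕ< p<n)) fp

  h-injective : Injective _≡_ _≡_ h
  h-injective {a} {b} eq = FinP.toℕ-injective (suc-injective
    (trans (sym (f∘h a)) (trans (cong (f ∘ toℕ) eq) (f∘h b))))

  h⁻¹ : Fin n → Fin n
  h⁻¹ e = proj₁ (injective⇒surjective h h-injective e)

  h∘h⁻¹ : ∀ e → h (h⁻¹ e) ≡ e
  h∘h⁻¹ e = proj₂ (injective⇒surjective h h-injective e)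

  h⁻¹∘h : ∀ y → h⁻¹ (h y) ≡ y
  h⁻¹∘h y = h-injective (h∘h⁻¹ (h y))

  f∘h⁻¹ : ∀ e → suc (toℕ (h⁻¹ e)) ≡ f (toℕ e)
  f∘h⁻¹ e = trans (sym (f∘h (h⁻¹ e))) (cong (f ∘ toℕ) (h∘h⁻¹ e))

labelAt : ∀ {n} → Permutation′ n → ℕ → ℕ
labelAt {n} π i with i <? n
... | yes i<n = suc (toℕ (π ⟨$⟩ʳ fromℕ< i<n))
... | no  _   = 0

labelAt-toℕ : ∀ {n} (π : Permutation′ n) e → suc (toℕ (π ⟨$⟩ʳ e)) ≡ labelAt π (toℕ e)
labelAt-toℕ {n} π e with toℕ e <? n
... | yes e<n = cong (λ e′ → suc (toℕ (π ⟨$⟩ʳ e′))) (sym (FinP.fromℕ<-toℕ e e<n))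
... | no  e≮n = ⊥-elim (e≮n (FinP.toℕ<n e))

labelAt-positive : ∀ {n} (π : Permutation′ n) {i} → i < n → 1 ≤ labelAt π i
labelAt-positive {n} π {i} i<n with i <? n
... | yes _   = s≤s z≤n
... | no  i≮n = ⊥-elim (i≮n i<n)

labelAt-≤ : ∀ {n} (π : Permutation′ n) {i} → i < n → labelAt π i ≤ n
labelAt-≤ {n} π {i} i<n with i <? n
... | yes _   = FinP.toℕ<n _
... | no  i≮n = ⊥-elim (i≮n i<n)

labelAt-injective : ∀ {n} (π : Permutation′ n) {i j} → i < n → j < n → labelAt π i ≡ labelAt π j → i ≡ j
labelAt-injective {n} π {i} {j} i<n j<n eq with i <? n | j <? n
... | yes i<n′ | yes j<n′ = trans (sym (FinP.toℕ-fromℕ< i<n′))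
      (trans (cong toℕ (π-injective (FinP.toℕ-injective (suc-injective eq)))) (FinP.toℕ-fromℕ< j<n′))
  where
  π-injective : ∀ {a b} → π ⟨$⟩ʳ a ≡ π ⟨$⟩ʳ b → a ≡ b
  π-injective {a} {b} eq = trans (sym (inverseˡ π)) (trans (cong (π ⟨$⟩ˡ_) eq) (inverseˡ π))
... | no i≮n | _      = ⊥-elim (i≮n i<n)
... | _      | no j≮n = ⊥-elim (j≮n j<n)

labelAt-top : ∀ {n} (π : Permutation′ (suc n)) → ∃ λ t → t < suc n × labelAt π t ≡ suc n
labelAt-top {n} π = toℕ top , FinP.toℕ<n top ,
  trans (sym (labelAt-toℕ π top)) (cong suc (trans (cong toℕ (inverseʳ π)) (FinP.toℕ-fromℕ n)))
  where
  top = π ⟨$⟩ˡ fromℕ n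

-- Sums over ranges of ℕ

∑< : ℕ → (ℕ → ℕ) → ℕ
∑< zero    f = 0
∑< (suc n) f = f 0 + ∑< n (f ∘ suc)

sum-tabulate : ∀ {n} (φ : Fin n → ℕ) (f : ℕ → ℕ) → (∀ i → φ i ≡ f (toℕ i)) → sum (tabulate φ) ≡ ∑< n f
sum-tabulate {zero}  φ f φ≗f = refl
sum-tabulate {suc n} φ f φ≗f = cong₂ _+_ (φ≗f fzero) (sum-tabulate (φ ∘ fsuc) (f ∘ suc) (φ≗f ∘ fsuc))

∑<-vanishing : ∀ n f → (∀ i → i < n → f i ≡ 0) → ∑< n f ≡ 0
∑<-vanishing zero    f f≡0 = refl
∑<-vanishing (suc n) f f≡0 = cong₂ _+_ (f≡0 0 (s≤s z≤n)) (∑<-vanishing n (f ∘ suc) (λ i i<n → f≡0 (suc i) (s≤s i<n)))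

erase : ℕ → (ℕ → ℕ) → ℕ → ℕ
erase a f i = if i ≡ᵇ a then 0 else f i

∑<-erase : ∀ n f {a} → a < n → ∑< n f ≡ f a + ∑< n (erase a f)
∑<-erase (suc n) f {zero}  _           = refl
∑<-erase (suc n) f {suc a} (s≤s a<n) =
  trans (cong (f 0 +_) (∑<-erase n (f ∘ suc) a<n)) (x∙yz≈y∙xz (f 0) (f (suc a)) _)

∑<-support : ∀ n f (as : List ℕ) → Unique as → All (_< n) as →
             (∀ i → i < n → i ∉ as → f i ≡ 0) → ∑< n f ≡ sum (map f as)
∑<-support n f []       _              _            outside = ∑<-vanishing n f (λ i i<n → outside i i<n λ ())
∑<-support n f (a ∷ as) (a∉as ∷ uniq) (a<n ∷ as<n) outside = begin
  ∑< n f                        ≡⟨ ∑<-erase n f a<n ⟩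
  f a + ∑< n (erase a f)        ≡⟨ cong (f a +_) (∑<-support n (erase a f) as uniq as<n erased-outside) ⟩
  f a + sum (map (erase a f) as) ≡⟨ cong (f a +_) (erase-off a∉as) ⟩
  f a + sum (map f as)          ∎
  where
  open ≡-Reasoning
  erased-outside : ∀ i → i < n → i ∉ as → erase a f i ≡ 0
  erased-outside i i<n i∉as with i ≡ᵇ a in i≡ᵇa
  ... | true  = refl
  ... | false = outside i i<n λ
    { (here refl)  → subst T i≡ᵇa (≡⇒≡ᵇ i i refl)
    ; (there i∈as) → i∉as i∈as }
  erase-off : ∀ {bs} → All (a ≢_) bs → sum (map (erase a f) bs) ≡ sum (map f bs)
  erase-off []             = refl
  erase-off {b ∷ _} (a≢b ∷ a≢bs) with b ≡ᵇ a in b≡ᵇa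
  ... | true  = ⊥-elim (a≢b (sym (≡ᵇ⇒≡ b a (subst T (sym b≡ᵇa) _))))
  ... | false = cong (f b +_) (erase-off a≢bs)

unique⊆⇒length≤ : ∀ {xs ys : List ℕ} → Unique xs → (∀ {z} → z ∈ xs → z ∈ ys) → length xs ≤ length ys
unique⊆⇒length≤ {[]}     _             _     = z≤n
unique⊆⇒length≤ {x ∷ xs} {ys} (x∉xs ∷ uniq) xs⊆ys =
  ≤-trans (s≤s (unique⊆⇒length≤ uniq xs⊆ys∖x)) (filter-notAll ≢x? ys (Any.map (λ x≡y y≢x → y≢x (sym x≡y)) (xs⊆ys (here refl))))
  where
  ≢x? : ∀ z → Dec (z ≢ x)
  ≢x? z = ¬? (z ≟ x)
  xs⊆ys∖x : ∀ {z} → z ∈ xs → z ∈ filter ≢x? ys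
  xs⊆ys∖x z∈xs = ∈-filter⁺ ≢x? (xs⊆ys (there z∈xs)) (λ z≡x → All.lookup x∉xs z∈xs (sym z≡x))

colours-≤ : ∀ G π (ys : List ℕ) → (∀ x → vsum G π x ∈ ys) → colours G π ≤ length ys
colours-≤ G π ys values∈ys = unique⊆⇒length≤ (deduplicate-! _≟_ values) λ z∈ →
  let x , _ , z≡ = ∈-map⁻ (vsum G π) (∈-deduplicate⁻ _≟_ values z∈) in subst (_∈ ys) (sym z≡) (values∈ys x)
  where
  values : List ℕ
  values = map (vsum G π) (allFin (n G))

≤-colours : ∀ G π (zs : List ℕ) → Unique zs → (∀ {z} → z ∈ zs → ∃ λ x → vsum G π x ≡ z) → length zs ≤ colours G π
≤-colours G π zs uniq realised = unique⊆⇒length≤ uniq λ z∈ →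
  let x , x↦z = realised z∈ in ∈-deduplicate⁺ _≟_ (subst (_∈ _) x↦z (∈-map⁺ (vsum G π) (∈-allFin x)))

-- Spiders in coordinates

⌊≟⌋-toℕ : ∀ {n} (a b : Fin n) → ⌊ a FinP.≟ b ⌋ ≡ ⌊ toℕ a ≟ toℕ b ⌋
⌊≟⌋-toℕ a b = trans (isYes≗does (a FinP.≟ b))
  (trans (does-⇔ (mk⇔ (cong toℕ) FinP.toℕ-injective) (a FinP.≟ b) (toℕ a ≟ toℕ b)) (sym (isYes≗does (toℕ a ≟ toℕ b))))

⌊≟⌋-refl : ∀ m → ⌊ m ≟ m ⌋ ≡ true
⌊≟⌋-refl m = trans (isYes≗does (m ≟ m)) (dec-true (m ≟ m) refl)

if-cases : ∀ b (x y : ℕ) → (T b × (if b then x else y) ≡ x) ⊎ (if b then x else y) ≡ y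
if-cases true  x y = inj₁ (tt , refl)
if-cases false x y = inj₂ refl

if-true : ∀ {b} {x y : ℕ} → b ≡ true → (if b then x else y) ≡ x
if-true refl = refl

if-off : ∀ b {x : ℕ} → ¬ T b → (if b then x else 0) ≡ 0
if-off true  ¬b = ⊥-elim (¬b tt)
if-off false ¬b = refl

module SpiderCoordinates (y₁ y₂ y₃ : ℕ) where

  G : Graph
  G = Spider y₁ y₂ y₃

  legStart : ℕ → Bool
  legStart i = ⌊ i ≟ 0 ⌋ ∨ ⌊ i ≟ y₁ ⌋ ∨ ⌊ i ≟ y₁ + y₂ ⌋

  -- edge i joins vertex tail i to vertex suc i
  tail : ℕ → ℕ
  tail i = if legStart i then 0 else i

  meets : ℕ → ℕ → Bool
  meets v i = ⌊ tail i ≟ v ⌋ ∨ ⌊ suc i ≟ v ⌋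

  toℕ-tail : ∀ e → toℕ (proj₁ (ends G e)) ≡ tail (toℕ e)
  toℕ-tail e = trans (if-float toℕ (legStart (toℕ e))) (if-cong-else (legStart (toℕ e)) (FinP.toℕ-inject₁ e))

  incident≡meets : ∀ x e → incident G x e ≡ meets (toℕ x) (toℕ e)
  incident≡meets x e = cong₂ _∨_
    (trans (⌊≟⌋-toℕ (proj₁ (ends G e)) x) (cong (λ t → ⌊ t ≟ toℕ x ⌋) (toℕ-tail e)))
    (⌊≟⌋-toℕ (fsuc e) x)

  legStart-inv : ∀ i → T (legStart i) → i ≡ 0 ⊎ i ≡ y₁ ⊎ i ≡ y₁ + y₂
  legStart-inv i start = Sum.map (toWitness {a? = i ≟ 0})
    (Sum.map (toWitness {a? = i ≟ y₁}) (toWitness {a? = i ≟ y₁ + y₂}) ∘ Equivalence.to T-∨)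
    (Equivalence.to T-∨ start)

  legStart-false : ∀ x → x ≢ 0 → x ≢ y₁ → x ≢ y₁ + y₂ → legStart x ≡ false
  legStart-false x x≢0 x≢y₁ x≢y₁+y₂ = cong₂ _∨_ (⌊≟⌋-no x≢0) (cong₂ _∨_ (⌊≟⌋-no x≢y₁) (⌊≟⌋-no x≢y₁+y₂))
    where
    ⌊≟⌋-no : ∀ {a b} → a ≢ b → ⌊ a ≟ b ⌋ ≡ false
    ⌊≟⌋-no {a} {b} a≢b = trans (isYes≗does (a ≟ b)) (dec-false (a ≟ b) a≢b)

  meets-inv : ∀ v i → T (meets v i) → tail i ≡ v ⊎ suc i ≡ v
  meets-inv v i m = Sum.map (toWitness {a? = tail i ≟ v}) (toWitness {a? = suc i ≟ v}) (Equivalence.to T-∨ m)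

  meets-tail : ∀ i → meets (tail i) i ≡ true
  meets-tail i = cong (_∨ ⌊ suc i ≟ tail i ⌋) (⌊≟⌋-refl (tail i))

  meets-head : ∀ i → meets (suc i) i ≡ true
  meets-head i = trans (cong (⌊ tail i ≟ suc i ⌋ ∨_) (⌊≟⌋-refl (suc i))) (∨-zeroʳ _)

  tail≡suc : ∀ i w → tail i ≡ suc w → i ≡ suc w
  tail≡suc i w tail≡ with if-cases (legStart i) 0 i
  ... | inj₁ (_ , tail≡0) = ⊥-elim (0≢1+n (trans (sym tail≡0) tail≡))
  ... | inj₂ tail≡i       = trans (sym tail≡i) tail≡

  starts-y₁ : T (legStart y₁)
  starts-y₁ = Equivalence.from (T-∨ {⌊ y₁ ≟ 0 ⌋}) (inj₂ (Equivalence.from T-∨ (inj₁ (fromWitness {a? = y₁ ≟ y₁} refl))))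

  starts-y₁+y₂ : T (legStart (y₁ + y₂))
  starts-y₁+y₂ = Equivalence.from (T-∨ {⌊ y₁ + y₂ ≟ 0 ⌋})
    (inj₂ (Equivalence.from (T-∨ {⌊ y₁ + y₂ ≟ y₁ ⌋}) (inj₂ (fromWitness {a? = y₁ + y₂ ≟ y₁ + y₂} refl))))

  tail-start : ∀ i → T (legStart i) → tail i ≡ 0
  tail-start i start = if-true (Equivalence.to T-≡ start)

  tail-inner : ∀ i → legStart i ≡ false → tail i ≡ i
  tail-inner i inner = cong (λ b → if b then 0 else i) inner

  start-meets-core : ∀ i → T (legStart i) → meets 0 i ≡ true
  start-meets-core i start = subst (λ v → meets v i ≡ true) (tail-start i start) (meets-tail i)

  module VertexSums (F : ℕ → ℕ) where

    summand : ℕ → ℕ → ℕ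
    summand v i = if meets v i then F i else 0

    V : ℕ → ℕ
    V v = ∑< (q G) (summand v)

    summand-meets : ∀ v i → meets v i ≡ true → summand v i ≡ F i
    summand-meets v i = if-true

    vsum≡V : (π : Labeling G) → (∀ e → label G π e ≡ F (toℕ e)) → ∀ x → vsum G π x ≡ V (toℕ x)
    vsum≡V π labels x = trans (cong sum (map-tabulate {n = q G} (λ e → e) term))
      (sum-tabulate _ _ λ e → trans (if-cong (incident≡meets x e)) (if-cong-then (meets (toℕ x) (toℕ e)) (labels e)))
      where
      term : Fin (q G) → ℕ
      term e = if incident G x e then label G π e else 0

    private
      support : ∀ v (as : List ℕ) → Unique as → All (_< q G) as → (∀ i → i < q G → T (meets v i) → i ∈ as) →
                V v ≡ sum (map (summand v) as)
      support v as uniq as<q meets⇒∈ = ∑<-support (q G) _ as uniq as<q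
        λ i i<q i∉as → if-off (meets v i) (λ m → i∉as (meets⇒∈ i i<q m))

    vertex-core : 1 ≤ y₁ → 1 ≤ y₂ → 1 ≤ y₃ → V 0 ≡ F 0 + F y₁ + F (y₁ + y₂)
    vertex-core 1≤y₁ 1≤y₂ 1≤y₃ = begin
      V 0
        ≡⟨ support 0 (0 ∷ y₁ ∷ y₁ + y₂ ∷ []) uniq (0<q ∷ y₁<q ∷ y₁+y₂<q ∷ []) edges ⟩
      summand 0 0 + (summand 0 y₁ + (summand 0 (y₁ + y₂) + 0))
        ≡⟨ cong₂ _+_ (summand-meets 0 0 (start-meets-core 0 _)) (cong₂ _+_ (summand-meets 0 y₁ (start-meets-core y₁ starts-y₁))
             (trans (+-identityʳ _) (summand-meets 0 (y₁ + y₂) (start-meets-core (y₁ + y₂) starts-y₁+y₂)))) ⟩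
      F 0 + (F y₁ + F (y₁ + y₂))
        ≡⟨ sym (+-assoc (F 0) _ _) ⟩
      F 0 + F y₁ + F (y₁ + y₂) ∎
      where
      open ≡-Reasoning
      y₁<y₁+y₂ : y₁ < y₁ + y₂
      y₁<y₁+y₂ = m<m+n y₁ 1≤y₂
      y₁+y₂<q : y₁ + y₂ < q G
      y₁+y₂<q = m<m+n (y₁ + y₂) 1≤y₃
      y₁<q : y₁ < q G
      y₁<q = <-trans y₁<y₁+y₂ y₁+y₂<q
      0<q : 0 < q G
      0<q = <-≤-trans 1≤y₁ (<⇒≤ y₁<q)
      uniq : Unique (0 ∷ y₁ ∷ y₁ + y₂ ∷ [])
      uniq = (<⇒≢ 1≤y₁ ∷ <⇒≢ (<-trans 1≤y₁ y₁<y₁+y₂) ∷ []) ∷ (<⇒≢ y₁<y₁+y₂ ∷ []) ∷ [] ∷ []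
      edges : ∀ i → i < q G → T (meets 0 i) → i ∈ 0 ∷ y₁ ∷ y₁ + y₂ ∷ []
      edges i _ m with meets-inv 0 i m | if-cases (legStart i) 0 i
      ... | inj₁ tail≡0 | inj₂ tail≡i     = here (trans (sym tail≡i) tail≡0)
      ... | inj₁ _      | inj₁ (start , _) with legStart-inv i start
      ...   | inj₁ i≡0            = here i≡0
      ...   | inj₂ (inj₁ i≡y₁)    = there (here i≡y₁)
      ...   | inj₂ (inj₂ i≡y₁+y₂) = there (there (here i≡y₁+y₂))

    vertex-inner : ∀ w → suc w < q G → legStart (suc w) ≡ false → V (suc w) ≡ F w + F (suc w)
    vertex-inner w sw<q inner = begin
      V (suc w)
        ≡⟨ support (suc w) (w ∷ suc w ∷ []) ((<⇒≢ (n<1+n w) ∷ []) ∷ [] ∷ []) (<-trans (n<1+n w) sw<q ∷ sw<q ∷ []) edges ⟩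
      summand (suc w) w + (summand (suc w) (suc w) + 0)
        ≡⟨ cong₂ _+_ (summand-meets (suc w) w (meets-head w)) (trans (+-identityʳ _) (summand-meets (suc w) (suc w) meets-own-tail)) ⟩
      F w + F (suc w) ∎
      where
      open ≡-Reasoning
      meets-own-tail : meets (suc w) (suc w) ≡ true
      meets-own-tail = subst (λ v → meets v (suc w) ≡ true) (tail-inner (suc w) inner) (meets-tail (suc w))
      edges : ∀ i → i < q G → T (meets (suc w) i) → i ∈ w ∷ suc w ∷ []
      edges i _ m with meets-inv (suc w) i m
      ... | inj₁ tail≡ = there (here (tail≡suc i w tail≡))
      ... | inj₂ refl  = here refl

    vertex-leaf : ∀ w → suc w ≤ q G → suc w ≡ q G ⊎ T (legStart (suc w)) → V (suc w) ≡ F w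
    vertex-leaf w sw≤q leaf = begin
      V (suc w)
        ≡⟨ support (suc w) (w ∷ []) ([] ∷ []) (sw≤q ∷ []) edges ⟩
      summand (suc w) w + 0
        ≡⟨ trans (+-identityʳ _) (summand-meets (suc w) w (meets-head w)) ⟩
      F w ∎
      where
      open ≡-Reasoning
      edges : ∀ i → i < q G → T (meets (suc w) i) → i ∈ w ∷ []
      edges i i<q m with meets-inv (suc w) i m
      ... | inj₂ refl  = here refl
      ... | inj₁ tail≡ with refl ← tail≡suc i w tail≡ = Sum.[ (λ sw≡q → ⊥-elim (<-irrefl sw≡q i<q))
                                                         , (λ start → ⊥-elim (0≢1+n (trans (sym (tail-start (suc w) start)) tail≡))) ] leaf

-- The lower bound

module LongLegs (z₁ z₂ z₃ : ℕ) where
  open SpiderCoordinates (2 + z₁) (2 + z₂) (2 + z₃) public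

  y₁<y₁+y₂ : 2 + z₁ < (2 + z₁) + (2 + z₂)
  y₁<y₁+y₂ = m<m+n (2 + z₁) (s≤s z≤n)

  y₁+y₂<q : (2 + z₁) + (2 + z₂) < q G
  y₁+y₂<q = m<m+n _ (s≤s z≤n)

  edge-at-inner-vertex : ∀ t → t < q G → ∃ λ w → suc w < q G × legStart (suc w) ≡ false × (t ≡ w ⊎ t ≡ suc w)
  edge-at-inner-vertex t t<q with suc t ≟ 2 + z₁ | suc t ≟ (2 + z₁) + (2 + z₂) | suc t ≟ q G
  ... | yes refl | _ | _ =
    z₁ , <-trans (n<1+n _) (<-trans y₁<y₁+y₂ y₁+y₂<q) ,
    legStart-false (suc z₁) (λ ()) (<⇒≢ ≤-refl) (<⇒≢ (<-trans ≤-refl y₁<y₁+y₂)) , inj₂ refl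
  ... | no _ | yes refl | _ =
    z₁ + (2 + z₂) , <-trans (n<1+n _) y₁+y₂<q ,
    legStart-false (suc (z₁ + (2 + z₂))) (λ ()) (≢-sym (<⇒≢ y₁<t)) (<⇒≢ ≤-refl) , inj₂ refl
    where
    y₁<t : 2 + z₁ < suc (z₁ + (2 + z₂))
    y₁<t = s≤s (subst (_≤ z₁ + (2 + z₂)) (+-comm z₁ 2) (+-monoʳ-≤ z₁ (m≤m+n 2 z₂)))
  ... | no _ | no _ | yes refl =
    z₁ + (2 + z₂) + (2 + z₃) , ≤-refl ,
    legStart-false (suc (z₁ + (2 + z₂) + (2 + z₃))) (λ ()) (≢-sym (<⇒≢ (<-trans y₁<y₁+y₂ y₁+y₂<t))) (≢-sym (<⇒≢ y₁+y₂<t)) , inj₂ refl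
    where
    y₁+y₂<t : (2 + z₁) + (2 + z₂) < suc (z₁ + (2 + z₂) + (2 + z₃))
    y₁+y₂<t = s≤s (subst (_≤ z₁ + (2 + z₂) + (2 + z₃)) (+-comm _ 2) (+-monoʳ-≤ (z₁ + (2 + z₂)) (m≤m+n 2 z₃)))
  ... | no ≢y₁ | no ≢y₁+y₂ | no ≢q = t , ≤∧≢⇒< t<q ≢q , legStart-false (suc t) (λ ()) ≢y₁ ≢y₁+y₂ , inj₁ refl

  pendant₁ pendant₂ pendant₃ : ℕ
  pendant₁ = suc z₁
  pendant₂ = suc (z₁ + (2 + z₂))
  pendant₃ = suc (z₁ + (2 + z₂) + (2 + z₃))

  pendant₁<pendant₂ : pendant₁ < pendant₂
  pendant₁<pendant₂ = s≤s (m<m+n z₁ (s≤s z≤n))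

  pendant₂<pendant₃ : pendant₂ < pendant₃
  pendant₂<pendant₃ = s≤s (m<m+n _ (s≤s z≤n))

  pendant₃<q : pendant₃ < q G
  pendant₃<q = ≤-refl

  module _ (π : Labeling G) where
    private
      F : ℕ → ℕ
      F = labelAt π
    open VertexSums F

    vsum-at : ∀ v → v ≤ q G → ∃ λ x → vsum G π x ≡ V v
    vsum-at v v≤q = fromℕ< (s≤s v≤q) , trans (vsum≡V π (labelAt-toℕ π) (fromℕ< (s≤s v≤q))) (cong V (FinP.toℕ-fromℕ< (s≤s v≤q)))

    leaf-values : ∀ {z} → z ∈ F pendant₁ ∷ F pendant₂ ∷ F pendant₃ ∷ [] → ∃ λ x → vsum G π x ≡ z
    leaf-values (here refl) = let x , eq = vsum-at (2 + z₁) y₁≤q in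
      x , trans eq (vertex-leaf pendant₁ y₁≤q (inj₂ starts-y₁))
      where
      y₁≤q : 2 + z₁ ≤ q G
      y₁≤q = <⇒≤ (<-trans y₁<y₁+y₂ y₁+y₂<q)
    leaf-values (there (here refl)) = let x , eq = vsum-at _ (<⇒≤ y₁+y₂<q) in
      x , trans eq (vertex-leaf pendant₂ (<⇒≤ y₁+y₂<q) (inj₂ starts-y₁+y₂))
    leaf-values (there (there (here refl))) = let x , eq = vsum-at (q G) ≤-refl in
      x , trans eq (vertex-leaf pendant₃ ≤-refl (inj₁ refl))

    heavy-vertex : ∃ λ w → suc w ≤ q G × q G < V (suc w)
    heavy-vertex with labelAt-top π
    ... | t , t<q , Ft≡q with edge-at-inner-vertex t t<q
    ... | w , sw<q , inner , t∈ = w , <⇒≤ sw<q , subst (q G <_) (sym (vertex-inner w sw<q inner)) (pair-exceeds t∈)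
      where
      pair-exceeds : t ≡ w ⊎ t ≡ suc w → q G < F w + F (suc w)
      pair-exceeds (inj₁ refl) = subst (λ y → q G < y + F (suc w)) (sym Ft≡q) (m<m+n (q G) (labelAt-positive π sw<q))
      pair-exceeds (inj₂ refl) = subst (λ y → q G < F w + y) (sym Ft≡q) (m<n+m (q G) (labelAt-positive π (<-trans (n<1+n w) sw<q)))

    colours-≥4 : 4 ≤ colours G π
    colours-≥4 = four-values heavy-vertex
      where
      pendant₂<q : pendant₂ < q G
      pendant₂<q = <-trans pendant₂<pendant₃ pendant₃<q
      pendant₁<q : pendant₁ < q G
      pendant₁<q = <-trans pendant₁<pendant₂ pendant₂<q
      F≢F : ∀ {a b} → a < q G → b < q G → a ≢ b → F a ≢ F b
      F≢F a<q b<q a≢b eq = a≢b (labelAt-injective π a<q b<q eq)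
      four-values : (∃ λ w → suc w ≤ q G × q G < V (suc w)) → 4 ≤ colours G π
      four-values (w , sw≤q , q<V) = ≤-colours G π (F pendant₁ ∷ F pendant₂ ∷ F pendant₃ ∷ V (suc w) ∷ []) distinct realised
        where
        F≢V : ∀ {a} → a < q G → F a ≢ V (suc w)
        F≢V a<q = <⇒≢ (≤-<-trans (labelAt-≤ π a<q) q<V)
        distinct : Unique (F pendant₁ ∷ F pendant₂ ∷ F pendant₃ ∷ V (suc w) ∷ [])
        distinct = (F≢F pendant₁<q pendant₂<q (<⇒≢ pendant₁<pendant₂)
                     ∷ F≢F pendant₁<q pendant₃<q (<⇒≢ (<-trans pendant₁<pendant₂ pendant₂<pendant₃)) ∷ F≢V pendant₁<q ∷ [])
                 ∷ (F≢F pendant₂<q pendant₃<q (<⇒≢ pendant₂<pendant₃) ∷ F≢V pendant₂<q ∷ [])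
                 ∷ (F≢V pendant₃<q ∷ [])
                 ∷ [] ∷ []
        realised : ∀ {z} → z ∈ F pendant₁ ∷ F pendant₂ ∷ F pendant₃ ∷ V (suc w) ∷ [] → ∃ λ x → vsum G π x ≡ z
        realised (here z≡)                 = leaf-values (here z≡)
        realised (there (here z≡))         = leaf-values (there (here z≡))
        realised (there (there (here z≡))) = leaf-values (there (there (here z≡)))
        realised (there (there (there (here refl)))) = vsum-at (suc w) sw≤q

-- Zigzag sequences

+≡⇒≤ : ∀ {m n} d → m + d ≡ n → m ≤ n
+≡⇒≤ {m} d refl = m≤m+n m d

append : ℕ → (ℕ → ℕ) → (ℕ → ℕ) → ℕ → ℕ
append zero    f g p       = g p
append (suc n) f g zero    = f 0
append (suc n) f g (suc p) = append n (f ∘ suc) g p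

append-left : ∀ n f g {p} → p < n → append n f g p ≡ f p
append-left (suc n) f g {zero}  _         = refl
append-left (suc n) f g {suc p} (s≤s p<n) = append-left n (f ∘ suc) g p<n

append-right : ∀ n f g u → append n f g (n + u) ≡ g u
append-right zero    f g u = refl
append-right (suc n) f g u = append-right n (f ∘ suc) g u

append-< : ∀ {k} e g h → (∀ p → g p < k) → (∀ p → h p < k) → ∀ p → append e g h p < k
append-< zero    g h g<k h<k p       = h<k p
append-< (suc e) g h g<k h<k zero    = g<k 0
append-< (suc e) g h g<k h<k (suc p) = append-< e (λ i → g (suc i)) h (λ i → g<k (suc i)) h<k p

append-≢ : ∀ e g h → (∀ p → suc p < e → g p ≢ g (suc p)) → (∀ p → h p ≢ h (suc p)) → (∀ p → g p ≢ h 0) →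
           ∀ p → append e g h p ≢ append e g h (suc p)
append-≢ zero          g h g≢ h≢ g≢h₀ p       = h≢ p
append-≢ (suc zero)    g h g≢ h≢ g≢h₀ zero    = g≢h₀ 0
append-≢ (suc (suc e)) g h g≢ h≢ g≢h₀ zero    = g≢ 0 (s≤s (s≤s z≤n))
append-≢ (suc e)       g h g≢ h≢ g≢h₀ (suc p) =
  append-≢ e (λ i → g (suc i)) h (λ i si<e → g≢ (suc i) (s≤s si<e)) h≢ (λ i → g≢h₀ (suc i)) p

interleave : (ℕ → ℕ) → (ℕ → ℕ) → ℕ → ℕ
interleave e o zero          = e 0
interleave e o (suc zero)    = o 0
interleave e o (suc (suc p)) = interleave (e ∘ suc) (o ∘ suc) p

interleave-even : ∀ e o t → interleave e o (2 * t) ≡ e t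
interleave-even e o zero    = refl
interleave-even e o (suc t) = trans (cong (interleave e o) (*-suc 2 t)) (interleave-even (e ∘ suc) (o ∘ suc) t)

interleave-odd : ∀ e o t → interleave e o (suc (2 * t)) ≡ o t
interleave-odd e o zero    = refl
interleave-odd e o (suc t) = trans (cong (interleave e o ∘ suc) (*-suc 2 t)) (interleave-odd (e ∘ suc) (o ∘ suc) t)

data EvenOdd : ℕ → Set where
  even : ∀ t → EvenOdd (2 * t)
  odd  : ∀ t → EvenOdd (suc (2 * t))

evenOdd : ∀ p → EvenOdd p
evenOdd zero = even 0
evenOdd (suc p) with evenOdd p
... | even t = odd t
... | odd  t = subst EvenOdd (*-suc 2 t) (even (suc t))

alternating : ℕ → ℕ → ℕ → ℕ
alternating a b = interleave (λ _ → a) (λ _ → b)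

alternating-≢ : ∀ {a b} → a ≢ b → ∀ p → alternating a b p ≢ alternating a b (suc p)
alternating-≢ a≢b zero          = a≢b
alternating-≢ a≢b (suc zero)    = ≢-sym a≢b
alternating-≢ a≢b (suc (suc p)) = alternating-≢ a≢b p

alternating-avoids : ∀ {a b v} → a ≢ v → b ≢ v → ∀ p → alternating a b p ≢ v
alternating-avoids a≢v b≢v zero          = a≢v
alternating-avoids a≢v b≢v (suc zero)    = b≢v
alternating-avoids a≢v b≢v (suc (suc p)) = alternating-avoids a≢v b≢v p

alternating-< : ∀ {a b k} → a < k → b < k → ∀ p → alternating a b p < k
alternating-< a<k b<k zero          = a<k
alternating-< a<k b<k (suc zero)    = b<k
alternating-< a<k b<k (suc (suc p)) = alternating-< a<k b<k p

∸-+-pair : ∀ {x A} B → x ≤ A → A ∸ x + (B + x) ≡ A + B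
∸-+-pair {x} {A} B x≤A = begin
  A ∸ x + (B + x) ≡⟨ cong (A ∸ x +_) (+-comm B x) ⟩
  A ∸ x + (x + B) ≡⟨ sym (+-assoc (A ∸ x) x B) ⟩
  A ∸ x + x + B   ≡⟨ cong (_+ B) (m∸n+n≡m x≤A) ⟩
  A + B           ∎
  where open ≡-Reasoning

zig : ℕ → ℕ → ℕ → ℕ
zig A B = interleave (λ t → A ∸ 2 * t) (λ t → B + 2 * t)

zig-even : ∀ A B t → zig A B (2 * t) ≡ A ∸ 2 * t
zig-even A B = interleave-even (λ t → A ∸ 2 * t) (λ t → B + 2 * t)

zig-odd : ∀ A B t → zig A B (suc (2 * t)) ≡ B + 2 * t
zig-odd A B = interleave-odd (λ t → A ∸ 2 * t) (λ t → B + 2 * t)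

zig-pairs : ∀ {A B R} → A + B ≡ R + 3 → ∀ p → suc p ≤ A → zig A B p + zig A B (suc p) ≡ R + alternating 3 1 p
zig-pairs {A} {B} {R} A+B p sp≤A with evenOdd p
... | even t = begin
  zig A B (2 * t) + zig A B (suc (2 * t)) ≡⟨ cong₂ _+_ (interleave-even _ _ t) (interleave-odd _ _ t) ⟩
  A ∸ 2 * t + (B + 2 * t)                 ≡⟨ ∸-+-pair B (<⇒≤ sp≤A) ⟩
  A + B                                   ≡⟨ A+B ⟩
  R + 3                                   ≡⟨ cong (R +_) (sym (interleave-even _ _ t)) ⟩
  R + alternating 3 1 (2 * t)             ∎
  where open ≡-Reasoning
... | odd t = +-cancelʳ-≡ 2 _ _ (begin
  zig A B (suc (2 * t)) + zig A B (2 + 2 * t) + 2 ≡⟨ cong₂ (λ x y → x + y + 2) (interleave-odd _ _ t) (interleave-even _ _ t) ⟩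
  B + 2 * t + (A ∸ 2 * suc t) + 2               ≡⟨ regroup B t (A ∸ 2 * suc t) ⟩
  A ∸ 2 * suc t + (B + 2 * suc t)               ≡⟨ ∸-+-pair B (subst (_≤ A) (sym (*-suc 2 t)) sp≤A) ⟩
  A + B                                         ≡⟨ A+B ⟩
  R + 3                                         ≡⟨ sym (+-assoc R 1 2) ⟩
  R + 1 + 2                                     ≡⟨ cong (λ x → R + x + 2) (sym (interleave-odd _ _ t)) ⟩
  R + alternating 3 1 (suc (2 * t)) + 2         ∎)
  where
  open ≡-Reasoning
  regroup : ∀ b t c → b + 2 * t + c + 2 ≡ c + (b + 2 * suc t)
  regroup = solve-∀

zag : ℕ → ℕ → ℕ → ℕ
zag A B = interleave (λ t → A + 2 * t) (λ t → B ∸ 2 * t)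

zag-even : ∀ A B t → zag A B (2 * t) ≡ A + 2 * t
zag-even A B = interleave-even (λ t → A + 2 * t) (λ t → B ∸ 2 * t)

zag-pairs : ∀ {A B R} → A + B ≡ R + 1 → ∀ p → p ≤ B → zag A B p + zag A B (suc p) ≡ R + alternating 1 3 p
zag-pairs {A} {B} {R} A+B p p≤B with evenOdd p
... | even t = begin
  zag A B (2 * t) + zag A B (suc (2 * t)) ≡⟨ cong₂ _+_ (interleave-even _ _ t) (interleave-odd _ _ t) ⟩
  A + 2 * t + (B ∸ 2 * t)                 ≡⟨ +-comm (A + 2 * t) _ ⟩
  B ∸ 2 * t + (A + 2 * t)                 ≡⟨ ∸-+-pair A p≤B ⟩
  B + A                                   ≡⟨ +-comm B A ⟩
  A + B                                   ≡⟨ A+B ⟩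
  R + 1                                   ≡⟨ cong (R +_) (sym (interleave-even _ _ t)) ⟩
  R + alternating 1 3 (2 * t)             ∎
  where open ≡-Reasoning
... | odd t = begin
  zag A B (suc (2 * t)) + zag A B (2 + 2 * t) ≡⟨ cong₂ _+_ (interleave-odd _ _ t) (interleave-even _ _ t) ⟩
  B ∸ 2 * t + (A + 2 * suc t)                 ≡⟨ cong (B ∸ 2 * t +_) (regroup A t) ⟩
  B ∸ 2 * t + ((A + 2) + 2 * t)               ≡⟨ ∸-+-pair (A + 2) (<⇒≤ p≤B) ⟩
  B + (A + 2)                                 ≡⟨ regroup′ B A ⟩
  A + B + 2                                   ≡⟨ cong (_+ 2) A+B ⟩
  R + 1 + 2                                   ≡⟨ +-assoc R 1 2 ⟩
  R + 3                                       ≡⟨ cong (R +_) (sym (interleave-odd _ _ t)) ⟩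
  R + alternating 1 3 (suc (2 * t))           ∎
  where
  open ≡-Reasoning
  regroup : ∀ a t → a + 2 * suc t ≡ a + 2 + 2 * t
  regroup = solve-∀
  regroup′ : ∀ b a → b + (a + 2) ≡ a + b + 2
  regroup′ = solve-∀

-- Covering [1, n] by progressions of step 2

record Covers (f : ℕ → ℕ) (n c N : ℕ) : Set where
  constructor covering
  field attained : ∀ s → s < N → Attains f n (c + 2 * s)

open Covers

covers-one : ∀ {f n c p} → p < n → f p ≡ c → Covers f n c 1
covers-one {c = c} p<n fp≡c = covering λ
  { zero    _        → _ , p<n , trans fp≡c (sym (+-identityʳ c))
  ; (suc s) (s≤s ()) }

covers-++ : ∀ {f n c N c′ M} → c + 2 * N ≡ c′ → Covers f n c N → Covers f n c′ M → Covers f n c (N + M)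
covers-++ {f} {n} {c} {N} {M = M} c′≡ lower upper = covering attained′
  where
  regroup : ∀ c N s′ → c + 2 * N + 2 * s′ ≡ c + 2 * (N + s′)
  regroup = solve-∀
  attained′ : ∀ s → s < N + M → Attains f n (c + 2 * s)
  attained′ s s<N+M with s <? N
  ... | yes s<N = attained lower s s<N
  ... | no  s≮N with m≤n⇒∃[o]m+o≡n (≮⇒≥ s≮N)
  ...   | s′ , refl = let p , p<n , fp≡ = attained upper s′ (+-cancelˡ-< N s′ M s<N+M) in
    p , p<n , trans fp≡ (trans (cong (_+ 2 * s′) (sym c′≡)) (regroup c N s′))

covers-append-left : ∀ {f g n m c N} → Covers f n c N → Covers (append n f g) (n + m) c N
covers-append-left {f} {g} {n} {m} covered = covering λ s s<N →
  let p , p<n , fp≡ = attained covered s s<N in p , ≤-trans p<n (m≤m+n n m) , trans (append-left n f g p<n) fp≡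

covers-append-right : ∀ {f g n m c N} → Covers g m c N → Covers (append n f g) (n + m) c N
covers-append-right {f} {g} {n} {m} covered = covering λ s s<N →
  let p , p<m , gp≡ = attained covered s s<N in n + p , +-monoʳ-< n p<m , trans (append-right n f g p) gp≡

Enumerates : (ℕ → ℕ) → ℕ → ℕ → Set
Enumerates e N c = ∀ s → s < N → ∃ λ t → t < N × e t ≡ c + 2 * s

ascending-enumerates : ∀ c N → Enumerates (λ t → c + 2 * t) N c
ascending-enumerates c N s s<N = s , s<N , refl

descending-enumerates : ∀ {A} c N → A + 2 ≡ c + 2 * N → Enumerates (λ t → A ∸ 2 * t) N c
descending-enumerates {A} c N A+2 s s<N with m≤n⇒∃[o]m+o≡n s<N
... | t , refl = t , m<n+m t (s≤s z≤n) , (begin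
  A ∸ 2 * t                   ≡⟨ cong (_∸ 2 * t) A≡ ⟩
  c + 2 * s + 2 * t ∸ 2 * t   ≡⟨ m+n∸n≡m (c + 2 * s) (2 * t) ⟩
  c + 2 * s                   ∎)
  where
  open ≡-Reasoning
  A≡ : A ≡ c + 2 * s + 2 * t
  A≡ = +-cancelʳ-≡ 2 _ _ (trans A+2 (regroup c s t))
    where regroup : ∀ c s t → c + 2 * (suc s + t) ≡ c + 2 * s + 2 * t + 2
          regroup = solve-∀

covers-evens : ∀ {e o n c N} → Enumerates e N c → 2 * N ≤ suc n → Covers (interleave e o) n c N
covers-evens {e} {o} {n} {N = N} enum 2N≤1+n = covering λ s s<N →
  let t , t<N , et≡ = enum s s<N in 2 * t , position t t<N , trans (interleave-even e o t) et≡
  where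
  position : ∀ t → t < N → 2 * t < n
  position t t<N = ≤-pred (≤-trans (subst (_≤ 2 * N) (*-suc 2 t) (*-monoʳ-≤ 2 t<N)) 2N≤1+n)

covers-odds : ∀ {e o n c N} → Enumerates o N c → 2 * N ≤ n → Covers (interleave e o) n c N
covers-odds {e} {o} {n} {N = N} enum 2N≤n = covering λ s s<N →
  let t , t<N , ot≡ = enum s s<N in suc (2 * t) , position t t<N , trans (interleave-odd e o t) ot≡
  where
  position : ∀ t → t < N → suc (2 * t) < n
  position t t<N = ≤-trans (subst (_≤ 2 * N) (*-suc 2 t) (*-monoʳ-≤ 2 t<N)) 2N≤n

half-≤ : ∀ a b → 2 * a ≤ suc (2 * b) → a ≤ b
half-≤ a b 2a≤1+2b with a ≤? b
... | yes a≤b = a≤b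
... | no  a≰b = ⊥-elim (<-irrefl refl (≤-trans (subst (_≤ 2 * a) (*-suc 2 b) (*-monoʳ-≤ 2 (≰⇒> a≰b))) 2a≤1+2b))

half-< : ∀ a b → suc (2 * a) ≤ 2 * b → a < b
half-< a b 1+2a≤2b with a <? b
... | yes a<b = a<b
... | no  a≮b = ⊥-elim (<-irrefl refl (≤-trans 1+2a≤2b (*-monoʳ-≤ 2 (≮⇒≥ a≮b))))

covers⇒onto : ∀ {f n N₁ N₂} → Covers f n 1 N₁ → Covers f n 2 N₂ → n ≤ 2 * N₁ → n ≤ suc (2 * N₂) → Onto f n
covers⇒onto {f} {n} {N₁} {N₂} odds evens n≤2N₁ n≤1+2N₂ l 1≤l l≤n with evenOdd l
... | odd s = attained odds s (half-< s N₁ (≤-trans l≤n n≤2N₁))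
... | even (suc s) = subst (Attains f n) (sym (*-suc 2 s))
  (attained evens s (half-≤ (suc s) N₂ (≤-trans l≤n n≤1+2N₂)))

palette : ℕ → List ℕ
palette R = applyUpTo (R +_) 4

-- For a leg with edge labels f 0, …, f (suc c) read from the core: its inner vertices have values
-- R + colour p, its leaf R + leaf, and the core R + 2.
record LegColouring (R c : ℕ) (f : ℕ → ℕ) : Set where
  field
    colour    : ℕ → ℕ
    pair-sums : ∀ p → p ≤ c → f p + f (suc p) ≡ R + colour p
    colour<4  : ∀ p → colour p < 4
    colour-≢  : ∀ p → colour p ≢ colour (suc p)
    colour₀≢2 : colour 0 ≢ 2
    leaf      : ℕ
    leaf<4    : leaf < 4
    leaf-sum  : f (suc c) ≡ R + leaf

append-pair-sums : ∀ {R k} e (f g cf cg : ℕ → ℕ) →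
  (∀ p → p < e → f p + f (suc p) ≡ R + cf p) → f e + g 0 ≡ R + 2 → (∀ u → u < k → g u + g (suc u) ≡ R + cg u) →
  ∀ p → p < suc e + k → append (suc e) f g p + append (suc e) f g (suc p) ≡ R + append e cf (append 1 (λ _ → 2) cg) p
append-pair-sums zero    f g cf cg f-pairs junction g-pairs zero    _         = junction
append-pair-sums zero    f g cf cg f-pairs junction g-pairs (suc u) (s≤s u<k) = g-pairs u u<k
append-pair-sums (suc e) f g cf cg f-pairs junction g-pairs zero    _         = f-pairs 0 (s≤s z≤n)
append-pair-sums (suc e) f g cf cg f-pairs junction g-pairs (suc p) (s≤s p<) =
  append-pair-sums e (λ i → f (suc i)) g (λ i → cf (suc i)) cg (λ i i<e → f-pairs (suc i) (s≤s i<e)) junction g-pairs p p<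

zig-leg : ∀ {R A B c} → A + B ≡ R + 3 → suc c ≤ A → ∀ leaf → leaf < 4 → zig A B (suc c) ≡ R + leaf →
          LegColouring R c (zig A B)
zig-leg A+B sc≤A leaf leaf<4 leaf-sum = record
  { colour    = alternating 3 1
  ; pair-sums = λ p p≤c → zig-pairs A+B p (≤-trans (s≤s p≤c) sc≤A)
  ; colour<4  = alternating-< ≤-refl (s≤s (s≤s z≤n))
  ; colour-≢  = alternating-≢ (λ ())
  ; colour₀≢2 = λ ()
  ; leaf      = leaf
  ; leaf<4    = leaf<4
  ; leaf-sum  = leaf-sum
  }

two-segment-leg : ∀ {R c d k} (f g cg : ℕ → ℕ) → c ≡ suc d + k →
  (∀ p → p < suc d → f p + f (suc p) ≡ R + alternating 3 1 p) → f (suc d) + g 0 ≡ R + 2 →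
  (∀ u → u < k → g u + g (suc u) ≡ R + cg u) →
  (∀ u → cg u ≢ cg (suc u)) → (∀ u → cg u ≢ 2) → (∀ u → cg u < 4) →
  ∀ leaf → leaf < 4 → append (2 + d) f g (suc c) ≡ R + leaf → LegColouring R c (append (2 + d) f g)
two-segment-leg {d = d} f g cg refl f-pairs junction g-pairs cg≢ cg≢2 cg<4 leaf leaf<4 leaf-sum = record
  { colour    = colour
  ; pair-sums = λ p p≤c → append-pair-sums (suc d) f g (alternating 3 1) cg f-pairs junction g-pairs p (s≤s p≤c)
  ; colour<4  = append-< (suc d) (alternating 3 1) after-junction (alternating-< ≤-refl (s≤s (s≤s z≤n)))
                  (append-< 1 (λ _ → 2) cg (λ _ → s≤s (s≤s (s≤s z≤n))) cg<4)
  ; colour-≢  = append-≢ (suc d) (alternating 3 1) after-junction (λ p _ → alternating-≢ (λ ()) p)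
                  (append-≢ 1 (λ _ → 2) cg (λ { _ (s≤s ()) }) cg≢ (λ _ 2≡ → cg≢2 0 (sym 2≡)))
                  (alternating-avoids (λ ()) (λ ()))
  ; colour₀≢2 = λ ()
  ; leaf      = leaf
  ; leaf<4    = leaf<4
  ; leaf-sum  = leaf-sum
  }
  where
  after-junction : ℕ → ℕ
  after-junction = append 1 (λ _ → 2) cg
  colour : ℕ → ℕ
  colour = append (suc d) (alternating 3 1) after-junction

-- The construction

<-+-view : ∀ m {n t} → t < m + n → t < m ⊎ ∃ λ p → p < n × t ≡ m + p
<-+-view m {n} {t} t<m+n with t <? m
... | yes t<m = inj₁ t<m
... | no  t≮m with m≤n⇒∃[o]m+o≡n (≮⇒≥ t≮m)
...   | p , refl = inj₂ (p , +-cancelˡ-< m p n t<m+n , refl)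

module Construction (a b : ℕ) where
  open SpiderCoordinates 2 (2 + a) (2 + b) public

  R : ℕ
  R = (2 + a) + (2 + b)

  first-leg : ℕ → ℕ
  first-leg zero    = 1
  first-leg (suc _) = 2 + R

  labels : (ℕ → ℕ) → (ℕ → ℕ) → ℕ → ℕ
  labels f₂ f₃ = append 2 first-leg (append (2 + a) f₂ f₃)

  module _ (f₂ f₃ : ℕ → ℕ) (onto : Onto (labels f₂ f₃) (q G)) (core-sum : 1 + f₂ 0 + f₃ 0 ≡ R + 2)
           (leg₂ : LegColouring R a f₂) (leg₃ : LegColouring R b f₃) where

    private
      F : ℕ → ℕ
      F = labels f₂ f₃

    open VertexSums F

    π : Labeling G
    π = proj₁ (onto⇒labelling F onto)

    vsum≡ : ∀ x → vsum G π x ≡ V (toℕ x)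
    vsum≡ = vsum≡V π (proj₂ (onto⇒labelling F onto))

    F-positive : ∀ {i} → i < q G → 1 ≤ F i
    F-positive i<q = subst (1 ≤_) (trans (proj₂ (onto⇒labelling F onto) (fromℕ< i<q)) (cong F (FinP.toℕ-fromℕ< i<q))) (s≤s z≤n)

    core-value : V 0 ≡ R + 2
    core-value = trans (vertex-core (s≤s z≤n) (s≤s z≤n) (s≤s z≤n))
      (trans (cong (λ x → 1 + f₂ 0 + x) (trans (cong (append (2 + a) f₂ f₃) (sym (+-identityʳ (2 + a)))) (append-right (2 + a) f₂ f₃ 0))) core-sum)

    module Leg (o c : ℕ) (f : ℕ → ℕ) (leg : LegColouring R c f)
               (F≡f : ∀ p → p < 2 + c → F (o + p) ≡ f p)
               (start : tail o ≡ 0)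
               (inner : ∀ p → p ≤ c → legStart (suc (o + p)) ≡ false)
               (end≤q : o + suc (suc c) ≤ q G)
               (end : o + suc (suc c) ≡ q G ⊎ T (legStart (o + suc (suc c)))) where
      open LegColouring leg

      inner<q : ∀ p → p ≤ c → suc (o + p) < q G
      inner<q p p≤c = ≤-trans (≤-reflexive (sym (trans (+-suc o (suc p)) (cong suc (+-suc o p)))))
                               (≤-trans (+-monoʳ-≤ o (s≤s (s≤s p≤c))) end≤q)

      inner-pair : ∀ p → p ≤ c → V (suc (o + p)) ≡ f p + f (suc p)
      inner-pair p p≤c = trans (vertex-inner (o + p) (inner<q p p≤c) (inner p p≤c))
        (cong₂ _+_ (F≡f p (s≤s (≤-trans p≤c (n≤1+n c)))) (trans (cong F (sym (+-suc o p))) (F≡f (suc p) (s≤s (s≤s p≤c)))))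

      inner-value : ∀ p → p ≤ c → V (suc (o + p)) ≡ R + colour p
      inner-value p p≤c = trans (inner-pair p p≤c) (pair-sums p p≤c)

      leaf-label : V (suc (o + suc c)) ≡ f (suc c)
      leaf-label = trans (vertex-leaf (o + suc c) (subst (_≤ q G) (+-suc o (suc c)) end≤q)
                                      (subst (λ v → v ≡ q G ⊎ T (legStart v)) (+-suc o (suc c)) end))
                         (F≡f (suc c) ≤-refl)

      values∈palette : ∀ p → p ≤ suc c → V (suc (o + p)) ∈ palette R
      values∈palette p p≤sc with m≤n⇒m<n∨m≡n p≤sc
      ... | inj₁ p<sc = subst (_∈ palette R) (sym (inner-value p (≤-pred p<sc))) (∈-applyUpTo⁺ (R +_) (colour<4 p))
      ... | inj₂ refl = subst (_∈ palette R) (sym (trans leaf-label leaf-sum)) (∈-applyUpTo⁺ (R +_) leaf<4)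

      along-leg : ∀ p → p ≤ c → V (tail (o + suc p)) ≡ V (suc (o + suc p)) → V (suc (o + p)) ≡ V (suc (o + suc p))
      along-leg p p≤c = trans (cong V (sym (trans (cong tail (+-suc o p)) (tail-inner (suc (o + p)) (inner p p≤c)))))

      edges-proper : ∀ p → p < 2 + c → V (tail (o + p)) ≢ V (suc (o + p))
      edges-proper zero _ eq = colour₀≢2 (sym (+-cancelˡ-≡ R _ _ (begin
        R + 2              ≡⟨ sym core-value ⟩
        V 0                ≡⟨ cong V (sym (trans (cong tail (+-identityʳ o)) start)) ⟩
        V (tail (o + 0))   ≡⟨ eq ⟩
        V (suc (o + 0))    ≡⟨ inner-value 0 z≤n ⟩
        R + colour 0       ∎)))
        where open ≡-Reasoning
      edges-proper (suc p) (s≤s (s≤s p≤c)) eq with suc p ≤? c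
      ... | yes sp≤c = colour-≢ p (+-cancelˡ-≡ R _ _ (trans (sym (inner-value p p≤c)) (trans (along-leg p p≤c eq) (inner-value (suc p) sp≤c))))
      ... | no  sp≰c with ≤-antisym p≤c (≮⇒≥ sp≰c)
      ...   | refl = <⇒≢ (m<n+m (f (suc c)) (subst (1 ≤_) (F≡f c (s≤s (n≤1+n c))) (F-positive (<-trans (n<1+n _) (inner<q c ≤-refl)))))
                      (sym (trans (sym (inner-pair c ≤-refl)) (trans (along-leg c ≤-refl eq) leaf-label)))

    module Leg₂ = Leg 2 a f₂ leg₂ (λ p → append-left (2 + a) f₂ f₃) (tail-start 2 starts-y₁)
      (λ p p≤a → legStart-false (3 + p) (λ ()) (λ ()) (<⇒≢ (s≤s (s≤s (s≤s (s≤s p≤a))))))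
      (s≤s (s≤s (s≤s (s≤s (m≤m+n a (2 + b)))))) (inj₂ starts-y₁+y₂)

    module Leg₃ = Leg (2 + (2 + a)) b f₃ leg₃ (λ p _ → append-right (2 + a) f₂ f₃ p)
      (tail-start (2 + (2 + a)) starts-y₁+y₂)
      (λ p _ → legStart-false (suc (2 + (2 + a) + p)) (λ ()) (λ ()) (≢-sym (<⇒≢ (s≤s (m≤m+n _ p)))))
      ≤-refl (inj₁ refl)

    private
      V₁ : V 1 ≡ R + 3
      V₁ = trans (vertex-inner 0 (s≤s (s≤s z≤n)) refl) (+-comm 3 R)

      V₂ : V 2 ≡ R + 2
      V₂ = trans (vertex-leaf 1 (s≤s (s≤s z≤n)) (inj₂ starts-y₁)) (+-comm 2 R)

    edge-values-differ : ∀ t → t < q G → V (tail t) ≢ V (suc t)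
    edge-values-differ t t<q with <-+-view 2 t<q
    ... | inj₁ (s≤s z≤n)       = λ eq → <⇒≢ (+-monoʳ-< R (n<1+n 2)) (trans (sym core-value) (trans eq V₁))
    ... | inj₁ (s≤s (s≤s z≤n)) = λ eq → <⇒≢ (+-monoʳ-< R (n<1+n 2)) (sym (trans (sym V₁) (trans eq V₂)))
    ... | inj₂ (t′ , t′<R , refl) with <-+-view (2 + a) t′<R
    ...   | inj₁ t′<L₂          = Leg₂.edges-proper t′ t′<L₂
    ...   | inj₂ (p , p<L₃ , refl) = Leg₃.edges-proper p p<L₃

    values-in-palette : ∀ v → v ≤ q G → V v ∈ palette R
    values-in-palette zero    _ = subst (_∈ palette R) (sym core-value) (∈-applyUpTo⁺ (R +_) (s≤s (s≤s (s≤s z≤n))))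
    values-in-palette (suc t) t<q with <-+-view 2 t<q
    ... | inj₁ (s≤s z≤n)       = subst (_∈ palette R) (sym V₁) (∈-applyUpTo⁺ (R +_) ≤-refl)
    ... | inj₁ (s≤s (s≤s z≤n)) = subst (_∈ palette R) (sym V₂) (∈-applyUpTo⁺ (R +_) (s≤s (s≤s (s≤s z≤n))))
    ... | inj₂ (t′ , t′<R , refl) with <-+-view (2 + a) t′<R
    ...   | inj₁ t′<L₂          = Leg₂.values∈palette t′ (≤-pred t′<L₂)
    ...   | inj₂ (p , p<L₃ , refl) = Leg₃.values∈palette p (≤-pred p<L₃)

    local-antimagic : LocalAntimagic G π
    local-antimagic e eq = edge-values-differ (toℕ e) (FinP.toℕ<n e)
      (trans (cong V (sym (toℕ-tail e))) (trans (sym (vsum≡ (proj₁ (ends G e)))) (trans eq (vsum≡ (fsuc e)))))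

    colours≤4 : colours G π ≤ 4
    colours≤4 = colours-≤ G π (palette R) λ x →
      subst (_∈ palette R) (sym (vsum≡ x)) (values-in-palette (toℕ x) (≤-pred (FinP.toℕ<n x)))

    χ-la≡4 : ChiLaIs G 4
    χ-la≡4 = (π , local-antimagic , ≤-antisym colours≤4 (LongLegs.colours-≥4 0 a b π))
           , λ π′ _ → LongLegs.colours-≥4 0 a b π′

module SecondLeg (m k : ℕ) where
  open Construction (2 * m) (2 * m + k) public

  f₂ : ℕ → ℕ
  f₂ = zig (2 + 2 * m) (5 + 2 * m + k)

  leg₂ : LegColouring R (2 * m) f₂
  leg₂ = zig-leg (ends-sum m k) (n≤1+n _) 1 (s≤s (s≤s z≤n)) (trans (zig-odd (2 + 2 * m) (5 + 2 * m + k) m) (leaf-sum m k))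
    where
    ends-sum : ∀ m k → (2 + 2 * m) + (5 + 2 * m + k) ≡ (2 + 2 * m) + (2 + (2 * m + k)) + 3
    ends-sum = solve-∀
    leaf-sum : ∀ m k → 5 + 2 * m + k + 2 * m ≡ (2 + 2 * m) + (2 + (2 * m + k)) + 1
    leaf-sum = solve-∀

  covers-leg₂ : ∀ f₃ {c N} → Covers f₂ (2 + 2 * m) c N → Covers (labels f₂ f₃) (q G) c N
  covers-leg₂ f₃ covered = covers-append-right {f = first-leg} {n = 2} (covers-append-left {g = f₃} {m = 2 + (2 * m + k)} covered)

  covers-leg₃ : ∀ f₃ {c N} → Covers f₃ (2 + (2 * m + k)) c N → Covers (labels f₂ f₃) (q G) c N
  covers-leg₃ f₃ covered = covers-append-right {f = first-leg} {n = 2} (covers-append-right {f = f₂} {n = 2 + 2 * m} covered)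

  covers-leg₂-evens : ∀ f₃ → Covers (labels f₂ f₃) (q G) 2 (1 + m)
  covers-leg₂-evens f₃ = covers-leg₂ f₃ (covers-evens (descending-enumerates 2 (1 + m) (top m)) (≤-trans (≤-reflexive (*-suc 2 m)) (n≤1+n _)))
    where
    top : ∀ m → 2 + 2 * m + 2 ≡ 2 + 2 * (1 + m)
    top = solve-∀

  covers-leg₂-odds : ∀ f₃ → Covers (labels f₂ f₃) (q G) (5 + 2 * m + k) (1 + m)
  covers-leg₂-odds f₃ = covers-leg₂ f₃ (covers-odds (ascending-enumerates (5 + 2 * m + k) (1 + m)) (≤-reflexive (*-suc 2 m)))

  covers-1 : ∀ f₃ → Covers (labels f₂ f₃) (q G) 1 1
  covers-1 f₃ = covers-one (s≤s z≤n) refl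

  covers-q : ∀ f₃ → Covers (labels f₂ f₃) (q G) (q G) 1
  covers-q f₃ = covers-one (s≤s (s≤s z≤n)) refl

module EvenExcess (m j : ℕ) where
  open SecondLeg m (2 + 2 * j)

  f₃ : ℕ → ℕ
  f₃ = zig (5 + 2 * m + 2 * j) (4 + 2 * m)

  leg₃ : LegColouring R (2 * m + (2 + 2 * j)) f₃
  leg₃ = zig-leg (ends-sum m j) (+≡⇒≤ 2 (below m j)) 0 (s≤s z≤n)
    (trans (cong (f₃ ∘ suc) (half m j)) (trans (zig-odd (5 + 2 * m + 2 * j) (4 + 2 * m) (1 + m + j)) (leaf-sum m j)))
    where
    ends-sum : ∀ m j → (5 + 2 * m + 2 * j) + (4 + 2 * m) ≡ (2 + 2 * m) + (2 + (2 * m + (2 + 2 * j))) + 3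
    ends-sum = solve-∀
    below : ∀ m j → suc (2 * m + (2 + 2 * j)) + 2 ≡ 5 + 2 * m + 2 * j
    below = solve-∀
    half : ∀ m j → 2 * m + (2 + 2 * j) ≡ 2 * (1 + m + j)
    half = solve-∀
    leaf-sum : ∀ m j → 4 + 2 * m + 2 * (1 + m + j) ≡ (2 + 2 * m) + (2 + (2 * m + (2 + 2 * j))) + 0
    leaf-sum = solve-∀

  core-sum : 1 + f₂ 0 + f₃ 0 ≡ R + 2
  core-sum = arith m j
    where
    arith : ∀ m j → 1 + (2 + 2 * m) + (5 + 2 * m + 2 * j) ≡ (2 + 2 * m) + (2 + (2 * m + (2 + 2 * j))) + 2
    arith = solve-∀

  onto : Onto (labels f₂ f₃) (q G)
  onto = covers⇒onto odds evens (≤-reflexive (odd-count m j)) (+≡⇒≤ 1 (even-count m j))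
    where
    leg₃-evens : Covers (labels f₂ f₃) (q G) 3 (2 + m + j)
    leg₃-evens = covers-leg₃ f₃ (covers-evens (descending-enumerates 3 (2 + m + j) (top m j)) (+≡⇒≤ 1 (room m j)))
      where
      top : ∀ m j → 5 + 2 * m + 2 * j + 2 ≡ 3 + 2 * (2 + m + j)
      top = solve-∀
      room : ∀ m j → 2 * (2 + m + j) + 1 ≡ suc (2 + (2 * m + (2 + 2 * j)))
      room = solve-∀
    leg₃-odds : Covers (labels f₂ f₃) (q G) (4 + 2 * m) (2 + m + j)
    leg₃-odds = covers-leg₃ f₃ (covers-odds (ascending-enumerates (4 + 2 * m) (2 + m + j)) (≤-reflexive (room m j)))
      where
      room : ∀ m j → 2 * (2 + m + j) ≡ 2 + (2 * m + (2 + 2 * j))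
      room = solve-∀
    odds : Covers (labels f₂ f₃) (q G) 1 (1 + ((2 + m + j) + (1 + m)))
    odds = covers-++ refl (covers-1 f₃) (covers-++ (next m j) leg₃-evens (covers-leg₂-odds f₃))
      where
      next : ∀ m j → 3 + 2 * (2 + m + j) ≡ 5 + 2 * m + (2 + 2 * j)
      next = solve-∀
    evens : Covers (labels f₂ f₃) (q G) 2 ((1 + m) + ((2 + m + j) + 1))
    evens = covers-++ (next m) (covers-leg₂-evens f₃) (covers-++ (next′ m j) leg₃-odds (covers-q f₃))
      where
      next : ∀ m → 2 + 2 * (1 + m) ≡ 4 + 2 * m
      next = solve-∀
      next′ : ∀ m j → 4 + 2 * m + 2 * (2 + m + j) ≡ 2 + ((2 + 2 * m) + (2 + (2 * m + (2 + 2 * j))))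
      next′ = solve-∀
    odd-count : ∀ m j → 2 + ((2 + 2 * m) + (2 + (2 * m + (2 + 2 * j)))) ≡ 2 * (1 + ((2 + m + j) + (1 + m)))
    odd-count = solve-∀
    even-count : ∀ m j → 2 + ((2 + 2 * m) + (2 + (2 * m + (2 + 2 * j)))) + 1 ≡ suc (2 * ((1 + m) + ((2 + m + j) + 1)))
    even-count = solve-∀

  χ-la : ChiLaIs (Spider 2 (2 + 2 * m) (2 + 2 * m + (2 + 2 * j))) 4
  χ-la = χ-la≡4 f₂ f₃ onto core-sum leg₂ leg₃

module ExcessThreeMod4 (m i : ℕ) where
  open SecondLeg m (3 + 4 * i)

  Ef Of f₃ : ℕ → ℕ
  Ef = zig (6 + 2 * m + 4 * i) (4 + 2 * m)
  Of = zag (5 + 2 * m + 2 * i) (3 + 2 * m + 2 * i)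
  f₃ = append (2 + 2 * i) Ef Of

  segment-lengths : ∀ m i → (2 + 2 * i) + (3 + 2 * m + 2 * i) ≡ 2 + (2 * m + (3 + 4 * i))
  segment-lengths = solve-∀

  leg₃ : LegColouring R (2 * m + (3 + 4 * i)) f₃
  leg₃ = two-segment-leg Ef Of (alternating 1 3) (shape m i)
    (λ p p<e → zig-pairs (E-sum m i) p (≤-trans p<e (+≡⇒≤ _ (E-room m i))))
    (trans (cong (_+ Of 0) (zig-odd (6 + 2 * m + 4 * i) (4 + 2 * m) i)) (junction m i))
    (λ u u<k → zag-pairs (O-sum m i) u (≤-trans (<⇒≤ u<k) (n≤1+n _)))
    (alternating-≢ (λ ())) (alternating-avoids (λ ()) (λ ())) (alternating-< (s≤s (s≤s z≤n)) ≤-refl)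
    0 (s≤s z≤n) (trans (cong f₃ (leaf-position m i)) (trans (append-right (2 + 2 * i) Ef Of _)
      (trans (zag-even (5 + 2 * m + 2 * i) (3 + 2 * m + 2 * i) (1 + m + i)) (leaf-sum m i))))
    where
    shape : ∀ m i → 2 * m + (3 + 4 * i) ≡ suc (2 * i) + (2 + 2 * m + 2 * i)
    shape = solve-∀
    E-sum : ∀ m i → (6 + 2 * m + 4 * i) + (4 + 2 * m) ≡ (2 + 2 * m) + (2 + (2 * m + (3 + 4 * i))) + 3
    E-sum = solve-∀
    E-room : ∀ m i → suc (2 * i) + (5 + 2 * m + 2 * i) ≡ 6 + 2 * m + 4 * i
    E-room = solve-∀
    junction : ∀ m i → (4 + 2 * m + 2 * i) + (5 + 2 * m + 2 * i + 2 * 0) ≡ (2 + 2 * m) + (2 + (2 * m + (3 + 4 * i))) + 2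
    junction = solve-∀
    O-sum : ∀ m i → (5 + 2 * m + 2 * i) + (3 + 2 * m + 2 * i) ≡ (2 + 2 * m) + (2 + (2 * m + (3 + 4 * i))) + 1
    O-sum = solve-∀
    leaf-position : ∀ m i → suc (2 * m + (3 + 4 * i)) ≡ (2 + 2 * i) + 2 * (1 + m + i)
    leaf-position = solve-∀
    leaf-sum : ∀ m i → 5 + 2 * m + 2 * i + 2 * (1 + m + i) ≡ (2 + 2 * m) + (2 + (2 * m + (3 + 4 * i))) + 0
    leaf-sum = solve-∀

  core-sum : 1 + f₂ 0 + f₃ 0 ≡ R + 2
  core-sum = arith m i
    where
    arith : ∀ m i → 1 + (2 + 2 * m) + (6 + 2 * m + 4 * i) ≡ (2 + 2 * m) + (2 + (2 * m + (3 + 4 * i))) + 2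
    arith = solve-∀

  covers-E : ∀ {c N} → Covers Ef (2 + 2 * i) c N → Covers (labels f₂ f₃) (q G) c N
  covers-E {c} {N} covered = covers-leg₃ f₃ (subst (λ n → Covers f₃ n c N) (segment-lengths m i) (covers-append-left {m = 3 + 2 * m + 2 * i} covered))

  covers-O : ∀ {c N} → Covers Of (3 + 2 * m + 2 * i) c N → Covers (labels f₂ f₃) (q G) c N
  covers-O {c} {N} covered = covers-leg₃ f₃ (subst (λ n → Covers f₃ n c N) (segment-lengths m i) (covers-append-right {n = 2 + 2 * i} covered))

  onto : Onto (labels f₂ f₃) (q G)
  onto = covers⇒onto odds evens (+≡⇒≤ 1 (odd-count m i)) (≤-reflexive (even-count m i))
    where
    odds : Covers (labels f₂ f₃) (q G) 1 (1 + ((1 + m + i) + ((2 + m + i) + 1)))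
    odds = covers-++ refl (covers-1 f₃) (covers-++ (next m i)
      (covers-O (covers-odds (descending-enumerates 3 (1 + m + i) (top m i)) (+≡⇒≤ 1 (room m i))))
      (covers-++ (next′ m i) (covers-O (covers-evens (ascending-enumerates (5 + 2 * m + 2 * i) (2 + m + i)) (≤-reflexive (room′ m i)))) (covers-q f₃)))
      where
      top : ∀ m i → 3 + 2 * m + 2 * i + 2 ≡ 3 + 2 * (1 + m + i)
      top = solve-∀
      room : ∀ m i → 2 * (1 + m + i) + 1 ≡ 3 + 2 * m + 2 * i
      room = solve-∀
      room′ : ∀ m i → 2 * (2 + m + i) ≡ suc (3 + 2 * m + 2 * i)
      room′ = solve-∀
      next : ∀ m i → 3 + 2 * (1 + m + i) ≡ 5 + 2 * m + 2 * i
      next = solve-∀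
      next′ : ∀ m i → 5 + 2 * m + 2 * i + 2 * (2 + m + i) ≡ 2 + ((2 + 2 * m) + (2 + (2 * m + (3 + 4 * i))))
      next′ = solve-∀
    evens : Covers (labels f₂ f₃) (q G) 2 ((1 + m) + ((1 + i) + ((1 + i) + (1 + m))))
    evens = covers-++ (next m) (covers-leg₂-evens f₃) (covers-++ (next′ m i)
      (covers-E (covers-odds (ascending-enumerates (4 + 2 * m) (1 + i)) (≤-reflexive room)))
      (covers-++ (next″ m i) (covers-E (covers-evens (descending-enumerates (6 + 2 * m + 2 * i) (1 + i) (top m i)) (+≡⇒≤ 1 (room′ i))))
        (covers-leg₂-odds f₃)))
      where
      room : 2 * (1 + i) ≡ 2 + 2 * i
      room = *-suc 2 i
      room′ : ∀ i → 2 * (1 + i) + 1 ≡ suc (2 + 2 * i)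
      room′ = solve-∀
      top : ∀ m i → 6 + 2 * m + 4 * i + 2 ≡ 6 + 2 * m + 2 * i + 2 * (1 + i)
      top = solve-∀
      next : ∀ m → 2 + 2 * (1 + m) ≡ 4 + 2 * m
      next = solve-∀
      next′ : ∀ m i → 4 + 2 * m + 2 * (1 + i) ≡ 6 + 2 * m + 2 * i
      next′ = solve-∀
      next″ : ∀ m i → 6 + 2 * m + 2 * i + 2 * (1 + i) ≡ 5 + 2 * m + (3 + 4 * i)
      next″ = solve-∀
    odd-count : ∀ m i → 2 + ((2 + 2 * m) + (2 + (2 * m + (3 + 4 * i)))) + 1 ≡ 2 * (1 + ((1 + m + i) + ((2 + m + i) + 1)))
    odd-count = solve-∀
    even-count : ∀ m i → 2 + ((2 + 2 * m) + (2 + (2 * m + (3 + 4 * i)))) ≡ suc (2 * ((1 + m) + ((1 + i) + ((1 + i) + (1 + m)))))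
    even-count = solve-∀

  χ-la : ChiLaIs (Spider 2 (2 + 2 * m) (2 + 2 * m + (3 + 4 * i))) 4
  χ-la = χ-la≡4 f₂ f₃ onto core-sum leg₂ leg₃

module ExcessOneMod4 (m i : ℕ) where
  open SecondLeg m (5 + 4 * i)

  Ef Of f₃ : ℕ → ℕ
  Ef = zig (8 + 2 * m + 4 * i) (4 + 2 * m)
  Of = zig (5 + 2 * m + 2 * i) (7 + 2 * m + 2 * i)
  f₃ = append (3 + 2 * i) Ef Of

  segment-lengths : ∀ m i → (3 + 2 * i) + (4 + 2 * m + 2 * i) ≡ 2 + (2 * m + (5 + 4 * i))
  segment-lengths = solve-∀

  leg₃ : LegColouring R (2 * m + (5 + 4 * i)) f₃
  leg₃ = two-segment-leg Ef Of (alternating 3 1) (shape m i)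
    (λ p p<e → zig-pairs (E-sum m i) p (≤-trans p<e (+≡⇒≤ _ (E-room m i))))
    (trans (cong (_+ Of 0) junction-label) (junction m i))
    (λ u u<k → zig-pairs (O-sum m i) u (≤-trans u<k (+≡⇒≤ 2 (O-room m i))))
    (alternating-≢ (λ ())) (alternating-avoids (λ ()) (λ ())) (alternating-< ≤-refl (s≤s (s≤s z≤n)))
    0 (s≤s z≤n) (trans (cong f₃ (leaf-position m i)) (trans (append-right (3 + 2 * i) Ef Of _)
      (trans (zig-odd (5 + 2 * m + 2 * i) (7 + 2 * m + 2 * i) (1 + m + i)) (leaf-sum m i))))
    where
    shape : ∀ m i → 2 * m + (5 + 4 * i) ≡ suc (1 + 2 * i) + (3 + 2 * m + 2 * i)
    shape = solve-∀
    E-sum : ∀ m i → (8 + 2 * m + 4 * i) + (4 + 2 * m) ≡ (2 + 2 * m) + (2 + (2 * m + (5 + 4 * i))) + 3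
    E-sum = solve-∀
    E-room : ∀ m i → 2 + 2 * i + (6 + 2 * m + 2 * i) ≡ 8 + 2 * m + 4 * i
    E-room = solve-∀
    junction-label : Ef (2 + 2 * i) ≡ 6 + 2 * m + 2 * i
    junction-label = begin
      Ef (2 + 2 * i)                              ≡⟨ cong Ef (sym (*-suc 2 i)) ⟩
      Ef (2 * (1 + i))                            ≡⟨ zig-even (8 + 2 * m + 4 * i) (4 + 2 * m) (1 + i) ⟩
      8 + 2 * m + 4 * i ∸ 2 * (1 + i)             ≡⟨ cong (_∸ 2 * (1 + i)) (top m i) ⟩
      6 + 2 * m + 2 * i + 2 * (1 + i) ∸ 2 * (1 + i) ≡⟨ m+n∸n≡m _ (2 * (1 + i)) ⟩
      6 + 2 * m + 2 * i                           ∎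
      where
      open ≡-Reasoning
      top : ∀ m i → 8 + 2 * m + 4 * i ≡ 6 + 2 * m + 2 * i + 2 * (1 + i)
      top = solve-∀
    junction : ∀ m i → (6 + 2 * m + 2 * i) + (5 + 2 * m + 2 * i) ≡ (2 + 2 * m) + (2 + (2 * m + (5 + 4 * i))) + 2
    junction = solve-∀
    O-sum : ∀ m i → (5 + 2 * m + 2 * i) + (7 + 2 * m + 2 * i) ≡ (2 + 2 * m) + (2 + (2 * m + (5 + 4 * i))) + 3
    O-sum = solve-∀
    O-room : ∀ m i → 3 + 2 * m + 2 * i + 2 ≡ 5 + 2 * m + 2 * i
    O-room = solve-∀
    leaf-position : ∀ m i → suc (2 * m + (5 + 4 * i)) ≡ (3 + 2 * i) + suc (2 * (1 + m + i))
    leaf-position = solve-∀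
    leaf-sum : ∀ m i → 7 + 2 * m + 2 * i + 2 * (1 + m + i) ≡ (2 + 2 * m) + (2 + (2 * m + (5 + 4 * i))) + 0
    leaf-sum = solve-∀

  core-sum : 1 + f₂ 0 + f₃ 0 ≡ R + 2
  core-sum = arith m i
    where
    arith : ∀ m i → 1 + (2 + 2 * m) + (8 + 2 * m + 4 * i) ≡ (2 + 2 * m) + (2 + (2 * m + (5 + 4 * i))) + 2
    arith = solve-∀

  covers-E : ∀ {c N} → Covers Ef (3 + 2 * i) c N → Covers (labels f₂ f₃) (q G) c N
  covers-E {c} {N} covered = covers-leg₃ f₃ (subst (λ n → Covers f₃ n c N) (segment-lengths m i) (covers-append-left {m = 4 + 2 * m + 2 * i} covered))

  covers-O : ∀ {c N} → Covers Of (4 + 2 * m + 2 * i) c N → Covers (labels f₂ f₃) (q G) c N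
  covers-O {c} {N} covered = covers-leg₃ f₃ (subst (λ n → Covers f₃ n c N) (segment-lengths m i) (covers-append-right {n = 3 + 2 * i} covered))

  onto : Onto (labels f₂ f₃) (q G)
  onto = covers⇒onto odds evens (+≡⇒≤ 1 (odd-count m i)) (≤-reflexive (even-count m i))
    where
    odds : Covers (labels f₂ f₃) (q G) 1 (1 + ((2 + m + i) + ((2 + m + i) + 1)))
    odds = covers-++ refl (covers-1 f₃) (covers-++ (next m i)
      (covers-O (covers-evens (descending-enumerates 3 (2 + m + i) (top m i)) (+≡⇒≤ 1 (room m i))))
      (covers-++ (next′ m i) (covers-O (covers-odds (ascending-enumerates (7 + 2 * m + 2 * i) (2 + m + i)) (≤-reflexive (room′ m i)))) (covers-q f₃)))
      where
      top : ∀ m i → 5 + 2 * m + 2 * i + 2 ≡ 3 + 2 * (2 + m + i)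
      top = solve-∀
      room : ∀ m i → 2 * (2 + m + i) + 1 ≡ suc (4 + 2 * m + 2 * i)
      room = solve-∀
      room′ : ∀ m i → 2 * (2 + m + i) ≡ 4 + 2 * m + 2 * i
      room′ = solve-∀
      next : ∀ m i → 3 + 2 * (2 + m + i) ≡ 7 + 2 * m + 2 * i
      next = solve-∀
      next′ : ∀ m i → 7 + 2 * m + 2 * i + 2 * (2 + m + i) ≡ 2 + ((2 + 2 * m) + (2 + (2 * m + (5 + 4 * i))))
      next′ = solve-∀
    evens : Covers (labels f₂ f₃) (q G) 2 ((1 + m) + ((1 + i) + ((2 + i) + (1 + m))))
    evens = covers-++ (next m) (covers-leg₂-evens f₃) (covers-++ (next′ m i)
      (covers-E (covers-odds (ascending-enumerates (4 + 2 * m) (1 + i)) (+≡⇒≤ 1 (room i))))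
      (covers-++ (next″ m i) (covers-E (covers-evens (descending-enumerates (6 + 2 * m + 2 * i) (2 + i) (top m i)) (≤-reflexive (room′ i))))
        (covers-leg₂-odds f₃)))
      where
      room : ∀ i → 2 * (1 + i) + 1 ≡ 3 + 2 * i
      room = solve-∀
      room′ : ∀ i → 2 * (2 + i) ≡ suc (3 + 2 * i)
      room′ = solve-∀
      top : ∀ m i → 8 + 2 * m + 4 * i + 2 ≡ 6 + 2 * m + 2 * i + 2 * (2 + i)
      top = solve-∀
      next : ∀ m → 2 + 2 * (1 + m) ≡ 4 + 2 * m
      next = solve-∀
      next′ : ∀ m i → 4 + 2 * m + 2 * (1 + i) ≡ 6 + 2 * m + 2 * i
      next′ = solve-∀
      next″ : ∀ m i → 6 + 2 * m + 2 * i + 2 * (2 + i) ≡ 5 + 2 * m + (5 + 4 * i)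
      next″ = solve-∀
    odd-count : ∀ m i → 2 + ((2 + 2 * m) + (2 + (2 * m + (5 + 4 * i)))) + 1 ≡ 2 * (1 + ((2 + m + i) + ((2 + m + i) + 1)))
    odd-count = solve-∀
    even-count : ∀ m i → 2 + ((2 + 2 * m) + (2 + (2 * m + (5 + 4 * i)))) ≡ suc (2 * ((1 + m) + ((1 + i) + ((2 + i) + (1 + m)))))
    even-count = solve-∀

  χ-la : ChiLaIs (Spider 2 (2 + 2 * m) (2 + 2 * m + (5 + 4 * i))) 4
  χ-la = χ-la≡4 f₂ f₃ onto core-sum leg₂ leg₃

data Excess : ℕ → Set where
  even-excess  : ∀ j → Excess (2 + 2 * j)
  three-mod-4  : ∀ i → Excess (3 + 4 * i)
  one-mod-4    : ∀ i → Excess (5 + 4 * i)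

excess : ∀ k → 2 ≤ k → Excess k
excess k 2≤k with evenOdd k
... | even (suc j) = subst Excess (sym (*-suc 2 j)) (even-excess j)
excess _ (s≤s ()) | odd zero
... | odd (suc t) with evenOdd t
...   | even i = subst Excess (three i) (three-mod-4 i)
  where
  three : ∀ i → 3 + 4 * i ≡ suc (2 * suc (2 * i))
  three = solve-∀
...   | odd  i = subst Excess (five i) (one-mod-4 i)
  where
  five : ∀ i → 5 + 4 * i ≡ suc (2 * suc (suc (2 * i)))
  five = solve-∀

χ-la-by-excess : ∀ m {k} → Excess k → ChiLaIs (Spider 2 (2 + 2 * m) (2 + 2 * m + k)) 4
χ-la-by-excess m (even-excess j) = EvenExcess.χ-la m j
χ-la-by-excess m (three-mod-4 i) = ExcessThreeMod4.χ-la m i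
χ-la-by-excess m (one-mod-4 i)   = ExcessOneMod4.χ-la m i

theorem3p4 : (m k : ℕ) → 2 ≤ k → ChiLaIs (Spider 2 (2 + 2 * m) (2 + 2 * m + k)) 4
theorem3p4 m k 2≤k = χ-la-by-excess m (excess k 2≤k)
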